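{- Let $L$ be the stratified complete lattice determined by the limit of an inverse system of complete lattices $L_\alpha$, $\alpha<\kappa$, with locally completely additive projections $h^\alpha_\beta:L_\alpha\to L_\beta$, $\beta<\alpha<\kappa$. Then $L$ is a symmetric model (equivalently, a strong symmetric model) iff all functions $h^\alpha_\beta$, $\beta<\alpha<\kappa$, are completely additive.
   Context: Fix a limit ordinal $\kappa$. A stratified complete lattice is $(L,\leq,(\sqsubseteq_\alpha)_{\alpha<\kappa})$ with $(L,\leq)$ a complete lattice and each $\sqsubseteq_\alpha$ a preorder; $x=_\alpha y$ means $x\sqsubseteq_\alpha y$ and $y\sqsubseteq_\alpha x$. Axioms: (A1) for $\alpha<\beta$, $x\sqsubseteq_\beta y$ implies $x=_\alpha y$; (A2) if $x=_\alpha y$ for all $\alpha$ then $x=y$; (A3) for all $x,\alpha$ there is $y$ with $x=_\alpha y$ such that $x\sqsubseteq_\alpha z$ implies $y\leq z$ (unique, $x|_\alpha$); (A4) for nonempty $I$ and $x_i=_\alpha y$, $\bigvee_i x_i=_\alpha y$; (A4$^*$) for any $I$ and $x_i=_\alpha y_i$, $\bigvee_i x_i=_\alpha\bigvee_i y_i$; (A5) $x\leq y$ implies $x|_\alpha\leq y|_\alpha$; (A6) if $x\leq y$ and $x=_\beta y$ for all $\beta<\alpha$ then $x\sqsubseteq_\alpha y$; (A3d) for all $x,\alpha$ there is $y$ with $x=_\alpha y$ such that $z\sqsubseteq_\alpha x$ implies $z\leq y$ (unique, $x|^\alpha$); (A4d) for nonempty $I$ and $x_i=_\alpha y$, $\bigwedge_i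 x_i=_\alpha y$; (A4$^*$d) for any $I$ and $x_i=_\alpha y_i$, $\bigwedge_i x_i=_\alpha\bigwedge_i y_i$; (A5d) $x\leq y$ implies $x|^\alpha\leq y|^\alpha$. Model: A1–A6. Strong model: A1, A2, A3, A4$^*$, A5, A6. Dual model: A1, A2, A3d, A4d, A5d, A6; strong dual model: A1, A2, A3d, A4$^*$d, A5d, A6. Symmetric model: model and dual model; strong symmetric model: strong model and strong dual model. For complete lattices $L,L'$, a monotone $h:L'\to L$ is a projection if there is monotone $k:L\to L'$ with $h\circ k=\mathrm{id}_L$ and $k(h(y))\leq y$ for all $y$; $h$ is completely additive if it preserves all suprema; locally completely additive if for every nonempty $Y\subseteq L'$ with $h(Y)=\{x\}$, $h(\bigvee Y)=x$. An inverse system: complete lattices $L_\alpha$ and projections $h^\alpha_\beta$ with $h^\beta_\gamma\circ h^\alpha_\beta=h^\alpha_\gamma$. Its limit is the set of $(x_\alpha)_{\alpha<\kappa}\in\prod L_\alpha$ with $h^\alpha_\beta(x_\alpha)=x_\beta$, ordered pointwise, with $x\sqsubseteq_\alpha y$ iff $x_\alpha\leq y_\alpha$ and $x_\beta=y_\beta$ for all $\beta<\alpha$. -}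

module Defs where

open import Level using (0ℓ)
open import Data.Product using (Σ; _×_; _,_; proj₁; proj₂)
open import Relation.Binary.Bundles using (Poset)
open import Relation.Binary.Structures using (IsStrictTotalOrder)
open import Relation.Binary.Core using (Rel)
open import Relation.Binary.PropositionalEquality using (_≡_)
open import Induction.WellFounded using (WellFounded)

-- Limit ordinals κ, presented (up to isomorphism) by the well-ordered
-- set {α | α < κ}: a well-founded strict total order which is nonempty
-- and has no greatest element.

record LimitOrdinal : Set₁ where
  field
    Idx     : Set
    _<_     : Rel Idx 0ℓ
    isSTO   : IsStrictTotalOrder _≡_ _<_
    wf      : WellFounded _<_
    nonzero : Idx
    noMax   : ∀ α → Σ Idx (λ β → α < β)

module _ {A : Set} (_≤_ : Rel A 0ℓ) where

  IsLub : {I : Set} → (I → A) → A → Set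
  IsLub {I} x s = (∀ i → x i ≤ s) × (∀ u → (∀ i → x i ≤ u) → s ≤ u)

  IsGlb : {I : Set} → (I → A) → A → Set
  IsGlb {I} x s = (∀ i → s ≤ x i) × (∀ u → (∀ i → u ≤ x i) → u ≤ s)

record CompleteLattice : Set₁ where
  field
    poset : Poset 0ℓ 0ℓ 0ℓ
  open Poset poset public
  field
    ⋁     : {I : Set} → (I → Carrier) → Carrier
    ⋁-lub : {I : Set} (x : I → Carrier) → IsLub _≤_ x (⋁ x)
    ⋀     : {I : Set} → (I → Carrier) → Carrier
    ⋀-glb : {I : Set} (x : I → Carrier) → IsGlb _≤_ x (⋀ x)

open CompleteLattice using (Carrier)

module _ (L' L : CompleteLattice) where
  private
    module L' = CompleteLattice L'
    module L  = CompleteLattice L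

  -- monotone maps between the underlying posets (respecting the setoid
  -- equality, as every function does in set-theoretic mathematics)
  IsMonotone : (Carrier L' → Carrier L) → Set
  IsMonotone f = (∀ {x y} → x L'.≈ y → f x L.≈ f y)
               × (∀ {x y} → x L'.≤ y → f x L.≤ f y)

  IsProjection : (Carrier L' → Carrier L) → Set
  IsProjection h =
    IsMonotone h ×
    Σ (Carrier L → Carrier L') (λ k →
         ((∀ {x y} → x L.≈ y → k x L'.≈ k y)
          × (∀ {x y} → x L.≤ y → k x L'.≤ k y))
       × (∀ x → h (k x) L.≈ x)
       × (∀ y → k (h y) L'.≤ y))

  CompletelyAdditive : (Carrier L' → Carrier L) → Set₁
  CompletelyAdditive h =
    ∀ {I : Set} (y : I → Carrier L') → h (L'.⋁ y) L.≈ L.⋁ (λ i → h (y i))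

  LocallyCompletelyAdditive : (Carrier L' → Carrier L) → Set₁
  LocallyCompletelyAdditive h =
    ∀ {I : Set} → I → (y : I → Carrier L') (x : Carrier L) →
    (∀ i → h (y i) L.≈ x) → h (L'.⋁ y) L.≈ x

module _ (κ : LimitOrdinal) where
  open LimitOrdinal κ

  record Stratified : Set₁ where
    field
      Car     : Set
      _≈_     : Rel Car 0ℓ
      _≤_     : Rel Car 0ℓ
      _⊑[_]_  : Car → Idx → Car → Set

  module Axioms (S : Stratified) where
    open Stratified S

    _=[_]_ : Car → Idx → Car → Set
    x =[ α ] y = (x ⊑[ α ] y) × (y ⊑[ α ] x)

    IsRes : Idx → Car → Car → Set
    IsRes α x y = (x =[ α ] y) × (∀ z → x ⊑[ α ] z → y ≤ z)

    IsResD : Idx → Car → Car → Set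
    IsResD α x y = (x =[ α ] y) × (∀ z → z ⊑[ α ] x → z ≤ y)

    A1 : Set
    A1 = ∀ {α β} → α < β → ∀ {x y} → x ⊑[ β ] y → x =[ α ] y
    A2 : Set
    A2 = ∀ {x y} → (∀ α → x =[ α ] y) → x ≈ y
    A3 : Set
    A3 = ∀ x α → Σ Car (IsRes α x)
    A4 : Set₁
    A4 = ∀ α {I : Set} → I → (x : I → Car) (y : Car) →
         (∀ i → x i =[ α ] y) → ∀ s → IsLub _≤_ x s → s =[ α ] y
    A4* : Set₁
    A4* = ∀ α {I : Set} (x y : I → Car) → (∀ i → x i =[ α ] y i) →
          ∀ s t → IsLub _≤_ x s → IsLub _≤_ y t → s =[ α ] t
    A5 : Set
    A5 = ∀ α {x y r s} → IsRes α x r → IsRes α y s → x ≤ y → r ≤ s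
    A6 : Set
    A6 = ∀ α {x y} → x ≤ y → (∀ β → β < α → x =[ β ] y) → x ⊑[ α ] y
    A3d : Set
    A3d = ∀ x α → Σ Car (IsResD α x)
    A4d : Set₁
    A4d = ∀ α {I : Set} → I → (x : I → Car) (y : Car) →
          (∀ i → x i =[ α ] y) → ∀ s → IsGlb _≤_ x s → s =[ α ] y
    A4*d : Set₁
    A4*d = ∀ α {I : Set} (x y : I → Car) → (∀ i → x i =[ α ] y i) →
           ∀ s t → IsGlb _≤_ x s → IsGlb _≤_ y t → s =[ α ] t
    A5d : Set
    A5d = ∀ α {x y r s} → IsResD α x r → IsResD α y s → x ≤ y → r ≤ s

    Model : Set₁
    Model        = A1 × A2 × A3 × A4 × A5 × A6
    StrongModel : Set₁
    StrongModel  = A1 × A2 × A3 × A4* × A5 × A6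
    DualModel : Set₁
    DualModel    = A1 × A2 × A3d × A4d × A5d × A6
    StrongDualModel : Set₁
    StrongDualModel = A1 × A2 × A3d × A4*d × A5d × A6
    SymmetricModel : Set₁
    SymmetricModel       = Model × DualModel
    StrongSymmetricModel : Set₁
    StrongSymmetricModel = StrongModel × StrongDualModel

  record InverseSystem : Set₁ where
    field
      L      : Idx → CompleteLattice
      h      : ∀ {α β} → .(β < α) → Carrier (L α) → Carrier (L β)
      h-proj : ∀ {α β} .(p : β < α) → IsProjection (L α) (L β) (h p)
      h-comp : ∀ {α β γ} .(p : γ < β) .(q : β < α) .(r : γ < α) x →
               CompleteLattice._≈_ (L γ) (h p (h q x)) (h r x)

  module _ (Sys : InverseSystem) where
    open InverseSystem Sys
    private
      module Lα (α : Idx) = CompleteLattice (L α)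

    LimCarrier : Set
    LimCarrier = Σ ((α : Idx) → Carrier (L α))
                   (λ x → ∀ α β (p : β < α) → Lα._≈_ β (h p (x α)) (x β))

    limit : Stratified
    limit = record
      { Car    = LimCarrier
      ; _≈_    = λ x y → ∀ α → Lα._≈_ α (proj₁ x α) (proj₁ y α)
      ; _≤_    = λ x y → ∀ α → Lα._≤_ α (proj₁ x α) (proj₁ y α)
      ; _⊑[_]_ = λ x α y → Lα._≤_ α (proj₁ x α) (proj₁ y α)
                           × (∀ β → β < α → Lα._≈_ β (proj₁ x β) (proj₁ y β))
      }

module Submission where

-- Everything rests on Galois connections.  Each projection h has a lower adjoint k
-- (k ⊣ h, h ∘ k = id).  A family of compatible sections σ of the projections (a
-- "splitting") lets an element w of a level L_γ generate a thread: project w below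
-- γ, apply σ above γ.  With σ = k the generated thread of x at γ is the lower
-- restriction x|_γ; and since h preserves infima (as a right adjoint) infima of
-- threads are levelwise.  This gives A1-A6 and the dual A4d/A4*d unconditionally.
-- If every h has a right adjoint g, the same argument with σ = g gives the upper
-- restriction x|^γ, and suprema of threads are levelwise: the upper half of the
-- axioms.  Conversely A3d and A5d build a right adjoint of every h from upper
-- restrictions.  Complete additivity is the same as having a right adjoint (the
-- residual ⋁{u | h u ≤ w}).

open import Level using (0ℓ)
open import Data.Product using (Σ; _×_; _,_; proj₁; proj₂; swap)
open import Data.Empty using (⊥-elim)
open import Function.Base using (_∘_)
open import Function.Bundles using (_⇔_; mk⇔)
open import Relation.Binary.Bundles using (Poset)
open import Relation.Binary.Definitions using (Adjoint; tri<; tri≈; tri>)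
open import Relation.Binary.Structures using (IsStrictTotalOrder)
open import Relation.Binary.PropositionalEquality using (refl)
import Relation.Binary.Properties.Poset as PosetProperties
import Relation.Binary.Reasoning.PartialOrder as PosetReasoning
open import Defs

lub-unique : (P : Poset 0ℓ 0ℓ 0ℓ) → let open Poset P in
             ∀ {I : Set} {x y : I → Carrier} {s t} →
             IsLub _≤_ x s → IsLub _≤_ y t → (∀ i → x i ≈ y i) → s ≈ t
lub-unique P (x≤s , s-least) (y≤t , t-least) x≈y =
  antisym (s-least _ (λ i → trans (reflexive (x≈y i)) (y≤t i)))
          (t-least _ (λ i → trans (reflexive (Eq.sym (x≈y i))) (x≤s i)))
  where open Poset P

glb-unique : (P : Poset 0ℓ 0ℓ 0ℓ) → let open Poset P in
             ∀ {I : Set} {x y : I → Carrier} {s t} →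
             IsGlb _≤_ x s → IsGlb _≤_ y t → (∀ i → x i ≈ y i) → s ≈ t
glb-unique P = lub-unique (PosetProperties.≥-poset P)

module Galois (A B : Poset 0ℓ 0ℓ 0ℓ) where
  private
    module A = Poset A
    module B = Poset B

  infix 4 _⊣_
  _⊣_ : (A.Carrier → B.Carrier) → (B.Carrier → A.Carrier) → Set
  f ⊣ g = Adjoint A._≤_ B._≤_ f g

  private variable
    f f' : A.Carrier → B.Carrier
    g g' : B.Carrier → A.Carrier

  unit : f ⊣ g → ∀ x → x A.≤ g (f x)
  unit adj x = proj₁ adj B.refl

  counit : f ⊣ g → ∀ y → f (g y) B.≤ y
  counit adj y = proj₂ adj A.refl

  ⊣-monotoneˡ : f ⊣ g → ∀ {x x'} → x A.≤ x' → f x B.≤ f x'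
  ⊣-monotoneˡ adj {x' = x'} x≤x' = proj₂ adj (A.trans x≤x' (unit adj x'))

  ⊣-from-unit-counit : (∀ {x x'} → x A.≤ x' → f x B.≤ f x') →
                       (∀ {y y'} → y B.≤ y' → g y A.≤ g y') →
                       (∀ x → x A.≤ g (f x)) → (∀ y → f (g y) B.≤ y) → f ⊣ g
  ⊣-from-unit-counit f-mono g-mono η ε =
    (λ fx≤y → A.trans (η _) (g-mono fx≤y)) ,
    (λ x≤gy → B.trans (f-mono x≤gy) (ε _))

  ⊣-preserves-lub : f ⊣ g → ∀ {I : Set} {x : I → A.Carrier} {s} →
                    IsLub A._≤_ x s → IsLub B._≤_ (f ∘ x) (f s)
  ⊣-preserves-lub {g = g} adj (x≤s , s-least) =
    (λ i → ⊣-monotoneˡ adj (x≤s i)) ,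
    (λ u fx≤u → proj₂ adj (s-least (g u) (λ i → proj₁ adj (fx≤u i))))

  ⊣-section : f ⊣ g → ∀ {s : B.Carrier → A.Carrier} → (∀ y → f (s y) B.≈ y) →
              ∀ y → f (g y) B.≈ y
  ⊣-section adj f∘s≈id y =
    B.antisym (counit adj y)
              (B.trans (B.reflexive (B.Eq.sym (f∘s≈id y)))
                       (⊣-monotoneˡ adj (proj₁ adj (B.reflexive (f∘s≈id y)))))

  ⊣-uniqueˡ : f ⊣ g → f' ⊣ g' → (∀ y → g y A.≈ g' y) →
              ∀ x → f x B.≈ f' x
  ⊣-uniqueˡ {f = f} {f' = f'} adj adj' g≈g' x =
    B.antisym (proj₂ adj (A.trans (unit adj' x) (A.reflexive (A.Eq.sym (g≈g' (f' x))))))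
              (proj₂ adj' (A.trans (unit adj x) (A.reflexive (g≈g' (f x)))))

module _ {A B C : Poset 0ℓ 0ℓ 0ℓ} where
  open Galois

  ⊣-compose : ∀ {f g f' g'} → _⊣_ A B f g → _⊣_ B C f' g' → _⊣_ A C (f' ∘ f) (g ∘ g')
  ⊣-compose adj adj' = proj₁ adj ∘ proj₁ adj' , proj₂ adj' ∘ proj₂ adj

-- The right-adjoint halves of the facts above, obtained by reversing both orders:
-- f ⊣ g for A, B is g ⊣ f for the reversed orders of B, A.
module GaloisDual (A B : Poset 0ℓ 0ℓ 0ℓ) where
  private
    module A = Poset A
    module B = Poset B
    module Rev = Galois (PosetProperties.≥-poset B) (PosetProperties.≥-poset A)
  open Galois A B using (_⊣_)

  private variable
    f f' : A.Carrier → B.Carrier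
    g g' : B.Carrier → A.Carrier

  reverse : f ⊣ g → g Rev.⊣ f
  reverse adj = swap adj

  ⊣-monotoneʳ : f ⊣ g → ∀ {y y'} → y B.≤ y' → g y A.≤ g y'
  ⊣-monotoneʳ adj = Rev.⊣-monotoneˡ (reverse adj)

  ⊣-preserves-glb : f ⊣ g → ∀ {I : Set} {y : I → B.Carrier} {s} →
                    IsGlb B._≤_ y s → IsGlb A._≤_ (g ∘ y) (g s)
  ⊣-preserves-glb adj = Rev.⊣-preserves-lub (reverse adj)

  ⊣-uniqueʳ : f ⊣ g → f' ⊣ g' → (∀ x → f x B.≈ f' x) →
              ∀ y → g y A.≈ g' y
  ⊣-uniqueʳ adj adj' = Rev.⊣-uniqueˡ (reverse adj) (reverse adj')

-- Between complete lattices, a monotone map preserves all suprema exactly when it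
-- has a right adjoint; the right adjoint is then the residual w ↦ ⋁ {u | f u ≤ w}.
module Residuation (A B : CompleteLattice) where
  private
    module A = CompleteLattice A
    module B = CompleteLattice B
  open Galois A.poset B.poset using (_⊣_; ⊣-preserves-lub)

  residual : (A.Carrier → B.Carrier) → B.Carrier → A.Carrier
  residual f w = A.⋁ {Σ A.Carrier (λ u → f u B.≤ w)} proj₁

  residual-⊣ : ∀ {f} → (∀ {x y} → x A.≤ y → f x B.≤ f y) →
               CompletelyAdditive A B f → f ⊣ residual f
  residual-⊣ {f} f-mono f-additive {u} {w} =
    (λ fu≤w → proj₁ (A.⋁-lub proj₁) (u , fu≤w)) ,
    (λ u≤rw → B.trans (f-mono u≤rw)
                        (B.trans (B.reflexive (f-additive proj₁))
                                 (proj₂ (B.⋁-lub (f ∘ proj₁)) w proj₂)))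

  ⊣⇒completely-additive : ∀ {f g} → f ⊣ g → CompletelyAdditive A B f
  ⊣⇒completely-additive {f} adj y =
    lub-unique B.poset (⊣-preserves-lub adj (A.⋁-lub y)) (B.⋁-lub (f ∘ y)) (λ _ → B.Eq.refl)

-- In any stratified structure with a reflexive order, A4 is the special case of
-- A4* for a constant right-hand family (whose supremum is its value); dually for A4d.
module _ {κ : LimitOrdinal} (S : Stratified κ) where
  open Stratified S using (_≤_)
  open Axioms κ S

  A4*⇒A4 : (∀ {x} → x ≤ x) → A4* → A4
  A4*⇒A4 ≤-refl a4* α i₀ x y x=y s s-lub =
    a4* α x (λ _ → y) x=y s y s-lub ((λ _ → ≤-refl) , λ _ y≤u → y≤u i₀)

  A4*d⇒A4d : (∀ {x} → x ≤ x) → A4*d → A4d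
  A4*d⇒A4d ≤-refl a4*d α i₀ x y x=y s s-glb =
    a4*d α x (λ _ → y) x=y s y s-glb ((λ _ → ≤-refl) , λ _ u≤y → u≤y i₀)

module Limit (κ : LimitOrdinal) (S : InverseSystem κ) where
  open LimitOrdinal κ
  open InverseSystem S
  open IsStrictTotalOrder isSTO using (compare) renaming (trans to <-trans)
  open Stratified (limit κ S) using (_⊑[_]_) renaming (_≤_ to _≤L_)
  open Axioms κ (limit κ S)

  module Lat (α : Idx) = CompleteLattice (L α)
  module ≤-Reasoning (α : Idx) = PosetReasoning (Lat.poset α)
  module Adj (α β : Idx) = Galois (Lat.poset α) (Lat.poset β)
  module AdjDual (α β : Idx) = GaloisDual (Lat.poset α) (Lat.poset β)

  C : Idx → Set
  C α = Lat.Carrier α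

  leq eq : ∀ α → C α → C α → Set
  leq α = Lat._≤_ α
  eq α = Lat._≈_ α
  infix 4 leq eq
  syntax leq α x y = x ≤[ α ] y
  syntax eq α x y = x ≈[ α ] y

  h-mono : ∀ {α β} .(p : β < α) {x y} → x ≤[ α ] y → h p x ≤[ β ] h p y
  h-mono p = proj₂ (proj₁ (h-proj p))

  h-cong : ∀ {α β} .(p : β < α) {x y} → x ≈[ α ] y → h p x ≈[ β ] h p y
  h-cong p = proj₁ (proj₁ (h-proj p))

  h-compose : ∀ {α β γ} (p : γ < β) (q : β < α) x → h p (h q x) ≈[ γ ] h (<-trans p q) x
  h-compose p q = h-comp p q (<-trans p q)

  k : ∀ {α β} → .(β < α) → C β → C α
  k p = proj₁ (proj₂ (h-proj p))

  h∘k : ∀ {α β} .(p : β < α) x → h p (k p x) ≈[ β ] x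
  h∘k p = proj₁ (proj₂ (proj₂ (proj₂ (h-proj p))))

  k⊣h : ∀ {α β} (p : β < α) → Adj._⊣_ β α (k p) (h p)
  k⊣h {α} {β} p = Adj.⊣-from-unit-counit β α
    (proj₂ (proj₁ (proj₂ (proj₂ (h-proj p))))) (h-mono p)
    (λ x → Lat.reflexive β (Lat.Eq.sym β (h∘k p x)))
    (proj₂ (proj₂ (proj₂ (proj₂ (h-proj p)))))

  Thread : Set
  Thread = LimCarrier κ S

  infixl 9 _at_
  _at_ : Thread → (α : Idx) → C α
  x at α = proj₁ x α

  thread : ∀ (x : Thread) {α β} (p : β < α) → h p (x at α) ≈[ β ] x at β
  thread x {α} {β} p = proj₂ x α β p

  ≤L-trans : ∀ {x y z} → x ≤L y → y ≤L z → x ≤L z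
  ≤L-trans x≤y y≤z α = Lat.trans α (x≤y α) (y≤z α)

  =⇒≈ : ∀ {x y} α → x =[ α ] y → x at α ≈[ α ] y at α
  =⇒≈ α ((x≤y , _) , (y≤x , _)) = Lat.antisym α x≤y y≤x

  agreeing-threads : ∀ {x y} α → x at α ≈[ α ] y at α → x =[ α ] y
  agreeing-threads {x} {y} α x≈y =
    (Lat.reflexive α x≈y , below) ,
    (Lat.reflexive α (Lat.Eq.sym α x≈y) , λ β p → Lat.Eq.sym β (below β p))
    where
      below : ∀ β → β < α → x at β ≈[ β ] y at β
      below β p = begin-equality
          x at β          ≈⟨ thread x p ⟨
          h p (x at α)    ≈⟨ h-cong p x≈y ⟩
          h p (y at α)    ≈⟨ thread y p ⟩
          y at β          ∎
        where open ≤-Reasoning β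

  a1 : A1
  a1 {α} α<β {x} {y} (_ , below) = agreeing-threads {x} {y} α (below α α<β)

  a2 : A2
  a2 {x} {y} x=y α = =⇒≈ {x} {y} α (x=y α)

  a6 : A6
  a6 α {x} {y} x≤y agree-below = x≤y α , λ β β<α → =⇒≈ {x} {y} β (agree-below β β<α)

  -- A splitting chooses monotone sections σ^α_β of the projections h^α_β that
  -- compose: σ^α_γ ≈ σ^α_β ∘ σ^β_γ.  It lets any element of any level generate a thread.
  record Splitting : Set where
    field
      σ         : ∀ {β α} → .(β < α) → C β → C α
      σ-mono    : ∀ {β α} (p : β < α) {x y} → x ≤[ β ] y → σ p x ≤[ α ] σ p y
      σ-section : ∀ {β α} (p : β < α) x → h p (σ p x) ≈[ β ] x
      σ-compose : ∀ {γ β α} (p : γ < β) (q : β < α) x →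
                  σ (<-trans p q) x ≈[ α ] σ q (σ p x)

    σ-coherent : ∀ {γ β α} (p : γ < β) (q : β < α) x → h q (σ (<-trans p q) x) ≈[ β ] σ p x
    σ-coherent {β = β} p q x = begin-equality
        h q (σ (<-trans p q) x)   ≈⟨ h-cong q (σ-compose p q x) ⟩
        h q (σ q (σ p x))         ≈⟨ σ-section q (σ p x) ⟩
        σ p x                     ∎
      where open ≤-Reasoning β

  module Generated (sp : Splitting) (γ : Idx) where
    open Splitting sp

    component : C γ → (δ : Idx) → C δ
    component w δ with compare δ γ
    ... | tri< δ<γ _ _ = h δ<γ w
    ... | tri≈ _ refl _ = w
    ... | tri> _ _ γ<δ = σ γ<δ w

    component-below : ∀ w {δ} (δ<γ : δ < γ) → component w δ ≈[ δ ] h δ<γ w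
    component-below w {δ} δ<γ with compare δ γ
    ... | tri< _ _ _    = Lat.Eq.refl δ
    ... | tri≈ δ≮γ _ _  = ⊥-elim (δ≮γ δ<γ)
    ... | tri> δ≮γ _ _  = ⊥-elim (δ≮γ δ<γ)

    component-at : ∀ w → component w γ ≈[ γ ] w
    component-at w with compare γ γ
    ... | tri< _ γ≢γ _  = ⊥-elim (γ≢γ refl)
    ... | tri≈ _ refl _ = Lat.Eq.refl γ
    ... | tri> _ γ≢γ _  = ⊥-elim (γ≢γ refl)

    component-mono : ∀ {w w'} → w ≤[ γ ] w' → ∀ δ → component w δ ≤[ δ ] component w' δ
    component-mono w≤w' δ with compare δ γ
    ... | tri< δ<γ _ _ = h-mono δ<γ w≤w'
    ... | tri≈ _ refl _ = w≤w'
    ... | tri> _ _ γ<δ = σ-mono γ<δ w≤w'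

    -- the components form a thread; the cases are ε < δ < γ, ε < δ = γ, and for
    -- γ < δ: ε < γ (section, then project), ε = γ (section), γ < ε (coherence)
    component-thread : ∀ w {δ ε} (ε<δ : ε < δ) → h ε<δ (component w δ) ≈[ ε ] component w ε
    component-thread w {δ} {ε} ε<δ with compare δ γ
    ... | tri< δ<γ _ _ = Lat.Eq.trans ε (h-compose ε<δ δ<γ w)
                                        (Lat.Eq.sym ε (component-below w (<-trans ε<δ δ<γ)))
    ... | tri≈ _ refl _ = Lat.Eq.sym ε (component-below w ε<δ)
    ... | tri> _ _ γ<δ with compare ε γ
    ...   | tri< ε<γ _ _  = Lat.Eq.trans ε (Lat.Eq.sym ε (h-compose ε<γ γ<δ (σ γ<δ w)))
                                           (h-cong ε<γ (σ-section γ<δ w))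
    ...   | tri≈ _ refl _ = σ-section γ<δ w
    ...   | tri> _ _ γ<ε  = σ-coherent γ<ε ε<δ w

    generated : C γ → Thread
    generated w = component w , λ δ ε ε<δ → component-thread w ε<δ

    generated-mono : ∀ {w w'} → w ≤[ γ ] w' → generated w ≤L generated w'
    generated-mono = component-mono

    generated-agrees : ∀ x → x =[ γ ] generated (x at γ)
    generated-agrees x = agreeing-threads {x} {generated (x at γ)} γ
                           (Lat.Eq.sym γ (component-at (x at γ)))

  -- The lower adjoints k compose up to ≈, since their right adjoints h do.
  lower-splitting : Splitting
  lower-splitting = record
    { σ         = k
    ; σ-mono    = λ p → Adj.⊣-monotoneˡ _ _ (k⊣h p)
    ; σ-section = λ p → h∘k p
    ; σ-compose = λ {γ} {β} {α} p q →
        Adj.⊣-uniqueˡ γ α (k⊣h (<-trans p q))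
          (⊣-compose {Lat.poset γ} {Lat.poset β} {Lat.poset α} (k⊣h p) (k⊣h q))
          (λ y → Lat.Eq.sym γ (h-compose p q y))
    }

  module Lower (γ : Idx) = Generated lower-splitting γ

  lower-least : ∀ x γ z → x ⊑[ γ ] z → Lower.generated γ (x at γ) ≤L z
  lower-least x γ z (xγ≤zγ , agree-below) δ with compare δ γ
  ... | tri< δ<γ _ _ = Lat.reflexive δ (Lat.Eq.trans δ (thread x δ<γ) (agree-below δ δ<γ))
  ... | tri≈ _ refl _ = xγ≤zγ
  ... | tri> _ _ γ<δ = proj₂ (k⊣h γ<δ)
                          (Lat.trans γ xγ≤zγ (Lat.reflexive γ (Lat.Eq.sym γ (thread z γ<δ))))

  lower-restriction : ∀ x γ → IsRes γ x (Lower.generated γ (x at γ))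
  lower-restriction x γ = Lower.generated-agrees γ x , lower-least x γ

  a3 : A3
  a3 x γ = Lower.generated γ (x at γ) , lower-restriction x γ

  a5 : A5
  a5 γ {x} {y} {r} {s} (_ , r-least) ((y⊑s , _) , _) x≤y =
    ≤L-trans {r} {x̂} {s} (r-least x̂ (proj₁ (Lower.generated-agrees γ x)))
             (≤L-trans {x̂} {ŷ} {s} (Lower.generated-mono γ (x≤y γ)) (lower-least y γ s y⊑s))
    where
      x̂ ŷ : Thread
      x̂ = Lower.generated γ (x at γ)
      ŷ = Lower.generated γ (y at γ)

  -- Infima of threads are computed levelwise, because each h, being a right
  -- adjoint, preserves infima.
  ⋀-thread : ∀ {I : Set} → (I → Thread) → Thread
  ⋀-thread x = (λ α → Lat.⋀ α (λ i → x i at α)) , λ α β p →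
    glb-unique (Lat.poset β) (AdjDual.⊣-preserves-glb β α (k⊣h p) (Lat.⋀-glb α _))
               (Lat.⋀-glb β _) (λ i → thread (x i) p)

  glb-levelwise : ∀ {I : Set} {x : I → Thread} {s} → IsGlb _≤L_ x s →
                  ∀ α → IsGlb (Lat._≤_ α) (λ i → x i at α) (s at α)
  glb-levelwise {x = x} (s≤x , s-greatest) α =
    (λ i → s≤x i α) ,
    (λ u u≤x → Lat.trans α (proj₂ (Lat.⋀-glb α _) u u≤x)
                           (s-greatest (⋀-thread x) (λ i β → proj₁ (Lat.⋀-glb β _) i) α))

  a4*d : A4*d
  a4*d α x y x=y s t s-glb t-glb = agreeing-threads {s} {t} α
    (glb-unique (Lat.poset α) (glb-levelwise {x = x} {s} s-glb α)
                (glb-levelwise {x = y} {t} t-glb α)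
                (λ i → =⇒≈ {x i} {y i} α (x=y i)))

  a4d : A4d
  a4d = A4*d⇒A4d (limit κ S) (λ α → Lat.refl α) a4*d

  -- When every projection h has a right adjoint g, the g form a second splitting
  -- and the dual half of the axioms holds as well.
  module UpperHalf (g : ∀ {α β} → .(β < α) → C β → C α)
                   (h⊣g : ∀ {α β} (p : β < α) → Adj._⊣_ α β (h p) (g p)) where

    -- the right adjoints g compose up to ≈, since their left adjoints h do
    upper-splitting : Splitting
    upper-splitting = record
      { σ         = g
      ; σ-mono    = λ p → AdjDual.⊣-monotoneʳ _ _ (h⊣g p)
      ; σ-section = λ p → Adj.⊣-section _ _ (h⊣g p) (h∘k p)
      ; σ-compose = λ {γ} {β} {α} p q →
          AdjDual.⊣-uniqueʳ α γ (h⊣g (<-trans p q))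
            (⊣-compose {Lat.poset α} {Lat.poset β} {Lat.poset γ} (h⊣g q) (h⊣g p))
            (λ x → Lat.Eq.sym γ (h-compose p q x))
      }

    module Upper (γ : Idx) = Generated upper-splitting γ

    upper-greatest : ∀ x γ z → z ⊑[ γ ] x → z ≤L Upper.generated γ (x at γ)
    upper-greatest x γ z (zγ≤xγ , agree-below) δ with compare δ γ
    ... | tri< δ<γ _ _ = Lat.reflexive δ (Lat.Eq.trans δ (agree-below δ δ<γ)
                                                         (Lat.Eq.sym δ (thread x δ<γ)))
    ... | tri≈ _ refl _ = zγ≤xγ
    ... | tri> _ _ γ<δ = proj₁ (h⊣g γ<δ) (Lat.trans γ (Lat.reflexive γ (thread z γ<δ)) zγ≤xγ)

    upper-restriction : ∀ x γ → IsResD γ x (Upper.generated γ (x at γ))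
    upper-restriction x γ = Upper.generated-agrees γ x , upper-greatest x γ

    a3d : A3d
    a3d x γ = Upper.generated γ (x at γ) , upper-restriction x γ

    a5d : A5d
    a5d γ {x} {y} {r} {s} ((_ , r⊑x) , _) (_ , s-greatest) x≤y =
      ≤L-trans {r} {x̂} {s} (upper-greatest x γ r r⊑x)
               (≤L-trans {x̂} {ŷ} {s} (Upper.generated-mono γ (x≤y γ))
                                     (s-greatest ŷ (proj₂ (Upper.generated-agrees γ y))))
      where
        x̂ ŷ : Thread
        x̂ = Upper.generated γ (x at γ)
        ŷ = Upper.generated γ (y at γ)

    -- Suprema of threads are computed levelwise, because each h, being a left
    -- adjoint, preserves suprema.
    ⋁-thread : ∀ {I : Set} → (I → Thread) → Thread
    ⋁-thread x = (λ α → Lat.⋁ α (λ i → x i at α)) , λ α β p →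
      lub-unique (Lat.poset β) (Adj.⊣-preserves-lub α β (h⊣g p) (Lat.⋁-lub α _))
                 (Lat.⋁-lub β _) (λ i → thread (x i) p)

    lub-levelwise : ∀ {I : Set} {x : I → Thread} {s} → IsLub _≤L_ x s →
                    ∀ α → IsLub (Lat._≤_ α) (λ i → x i at α) (s at α)
    lub-levelwise {x = x} (x≤s , s-least) α =
      (λ i → x≤s i α) ,
      (λ u x≤u → Lat.trans α (s-least (⋁-thread x) (λ i β → proj₁ (Lat.⋁-lub β _) i) α)
                             (proj₂ (Lat.⋁-lub α _) u x≤u))

    a4* : A4*
    a4* α x y x=y s t s-lub t-lub = agreeing-threads {s} {t} α
      (lub-unique (Lat.poset α) (lub-levelwise {x = x} {s} s-lub α)
                  (lub-levelwise {x = y} {t} t-lub α)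
                  (λ i → =⇒≈ {x i} {y i} α (x=y i)))

    a4 : A4
    a4 = A4*⇒A4 (limit κ S) (λ α → Lat.refl α) a4*

    symmetric-model : SymmetricModel
    symmetric-model =
      ((λ {α β} → a1 {α} {β}) , (λ {x y} → a2 {x} {y}) , a3 , a4 , a5 , a6) ,
      ((λ {α β} → a1 {α} {β}) , (λ {x y} → a2 {x} {y}) , a3d , a4d , a5d , a6)

    strong-symmetric-model : StrongSymmetricModel
    strong-symmetric-model =
      ((λ {α β} → a1 {α} {β}) , (λ {x y} → a2 {x} {y}) , a3 , a4* , a5 , a6) ,
      ((λ {α β} → a1 {α} {β}) , (λ {x y} → a2 {x} {y}) , a3d , a4*d , a5d , a6)

  -- Conversely, upper restrictions yield a right adjoint of each h^α_β:
  -- g w = (ŵ|^β) at α, where ŵ is the thread generated by w ∈ L_β through k.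
  module FromUpperRestrictions (a3d : A3d) (a5d : A5d) where

    upper-restrict : Idx → Thread → Thread
    upper-restrict β x = proj₁ (a3d x β)

    g : ∀ {α β} → .(β < α) → C β → C α
    g {α} {β} _ w = upper-restrict β (Lower.generated β w) at α

    h⊣g : ∀ {α β} (p : β < α) → Adj._⊣_ α β (h p) (g p)
    h⊣g {α} {β} p = Adj.⊣-from-unit-counit α β (h-mono p) g-mono unit counit
      where
        restriction : ∀ w → IsResD β (Lower.generated β w) (upper-restrict β (Lower.generated β w))
        restriction w = proj₂ (a3d (Lower.generated β w) β)

        g-mono : ∀ {w w'} → w ≤[ β ] w' → g p w ≤[ α ] g p w'
        g-mono {w} {w'} w≤w' =
          a5d β {Lower.generated β w} {Lower.generated β w'}
                {upper-restrict β (Lower.generated β w)} {upper-restrict β (Lower.generated β w')}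
                (restriction w) (restriction w') (Lower.generated-mono β w≤w') α

        same-up-to-β : ∀ u → Lower.generated α u =[ β ] Lower.generated β (h p u)
        same-up-to-β u = agreeing-threads {Lower.generated α u} {Lower.generated β (h p u)} β
          (Lat.Eq.trans β (Lower.component-below α u p)
                          (Lat.Eq.sym β (Lower.component-at β (h p u))))

        unit : ∀ u → u ≤[ α ] g p (h p u)
        unit u = begin
            u                           ≈⟨ Lower.component-at α u ⟨
            Lower.generated α u at α    ≤⟨ proj₂ (restriction (h p u)) (Lower.generated α u)
                                                 (proj₁ (same-up-to-β u)) α ⟩
            g p (h p u)                 ∎
          where open ≤-Reasoning α

        counit : ∀ w → h p (g p w) ≤[ β ] w
        counit w = begin
            h p (g p w)                 ≈⟨ thread r p ⟩
            r at β                      ≤⟨ proj₁ (proj₂ (proj₁ (restriction w))) ⟩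
            Lower.generated β w at β    ≈⟨ Lower.component-at β w ⟩
            w                           ∎
          where
            open ≤-Reasoning β
            r : Thread
            r = upper-restrict β (Lower.generated β w)

  AllAdditive : Set₁
  AllAdditive = ∀ {α β} (p : β < α) → CompletelyAdditive (L α) (L β) (h p)

  additive-from-upper-restrictions : A3d → A5d → AllAdditive
  additive-from-upper-restrictions a3d a5d {α} {β} p =
    Residuation.⊣⇒completely-additive (L α) (L β) (FromUpperRestrictions.h⊣g a3d a5d p)

  module FromAdditivity (additive : AllAdditive) =
    UpperHalf (λ {α} {β} p → Residuation.residual (L α) (L β) (h p))
              (λ {α} {β} p → Residuation.residual-⊣ (L α) (L β) (h-mono p) (additive p))

-- The forward direction uses only A3d and A5d of the dual half.
corollary23 : (κ : LimitOrdinal) (S : InverseSystem κ) →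
    (∀ {α β} (p : LimitOrdinal._<_ κ β α) →
    LocallyCompletelyAdditive (InverseSystem.L S α) (InverseSystem.L S β) (InverseSystem.h S p)) →
    (Axioms.SymmetricModel κ (limit κ S) ⇔
    (∀ {α β} (p : LimitOrdinal._<_ κ β α) →
    CompletelyAdditive (InverseSystem.L S α) (InverseSystem.L S β) (InverseSystem.h S p)))
    × (Axioms.StrongSymmetricModel κ (limit κ S) ⇔
    (∀ {α β} (p : LimitOrdinal._<_ κ β α) →
    CompletelyAdditive (InverseSystem.L S α) (InverseSystem.L S β) (InverseSystem.h S p)))
corollary23 κ S _ =
  mk⇔ (λ (_ , (_ , _ , a3d , _ , a5d , _)) → additive-from-upper-restrictions a3d a5d)
      FromAdditivity.symmetric-model ,
  mk⇔ (λ (_ , (_ , _ , a3d , _ , a5d , _)) → additive-from-upper-restrictions a3d a5d)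
      FromAdditivity.strong-symmetric-model
  where open Limit κ S
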